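{- If $G$ is a trigraph with $\operatorname{stww}(G)>\Delta(G)^2$, then $\operatorname{stww}(G)=\operatorname{tww}(G)$.
   Context: A trigraph is a finite simple graph whose edges are colored red or black; $\Delta(G)$ is the maximum degree of the underlying graph (counting both colors). For a partition $\mathcal{P}$ of $V(G)$, the quotient trigraph $G/\mathcal{P}$ has vertex set $\mathcal{P}$; two parts $U,W$ are joined by a black edge if every pair $u\in U,w\in W$ is a black edge, are non-adjacent if no such pair is an edge, and are joined by a red edge otherwise. A contraction sequence of an $n$-vertex trigraph $G$ is a sequence $\mathcal{P}_n,\dots,\mathcal{P}_1$ of partitions with $\mathcal{P}_n$ discrete and each $\mathcal{P}_i$ obtained from $\mathcal{P}_{i+1}$ by merging two parts; its width is the maximum red degree over all $G/\mathcal{P}_i$; $\operatorname{tww}(G)$ is the minimum width. The sparse twin-width is $\operatorname{stww}(G)\coloneqq\operatorname{tww}(G_{\mathrm{red}})$, where $G_{\mathrm{red}}$ is obtained from $G$ by coloring all edges red. -}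

module Defs where

open import Data.Nat using (ℕ; zero; suc; _≤_; _<_; _⊔_)
open import Data.Fin using (Fin)
open import Data.Fin.Properties using () renaming (_≟_ to _≟ᶠ_)
open import Data.Bool using (Bool; true; false; _∧_; not; if_then_else_)
open import Data.List using (List; length; filter; map; foldr)
open import Data.List.Base using (allFin)
open import Data.Product using (Σ; ∃; ∃-syntax; _×_; _,_)
open import Data.Sum using (_⊎_)
open import Relation.Nullary using (¬_; does)
open import Relation.Binary.PropositionalEquality using (_≡_; _≢_)
open import Function.Bundles using (_⇔_)

data Colour : Set where
  none black red : Colour

isNone isBlack isRed : Colour → Bool
isNone none = true
isNone _ = false
isBlack black = true
isBlack _ = false
isRed red = true
isRed _ = false

isEdge : Colour → Bool
isEdge c = not (isNone c)

record Trigraph (n : ℕ) : Set where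
  field
    col    : Fin n → Fin n → Colour
    sym    : ∀ x y → col x y ≡ col y x
    irrefl : ∀ x → col x x ≡ none
open Trigraph public

redden : Colour → Colour
redden none = none
redden black = red
redden red = red

Gred : ∀ {n} → Trigraph n → Trigraph n
Gred G = record
  { col    = λ x y → redden (col G x y)
  ; sym    = λ x y → Relation.Binary.PropositionalEquality.cong redden (sym G x y)
  ; irrefl = λ x → Relation.Binary.PropositionalEquality.cong redden (irrefl G x)
  }

allF : ∀ {n} → (Fin n → Bool) → Bool
allF {n} p = foldr (λ x b → p x ∧ b) true (allFin n)

anyF : ∀ {n} → (Fin n → Bool) → Bool
anyF p = not (allF (λ x → not (p x)))

countF : ∀ {n} → (Fin n → Bool) → ℕ
countF {n} p = length (filter (λ x → p x Data.Bool.≟ true) (allFin n))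

deg : ∀ {n} → Trigraph n → Fin n → ℕ
deg G v = countF (λ w → isEdge (col G v w))

Δ : ∀ {n} → Trigraph n → ℕ
Δ {n} G = foldr (λ v m → deg G v ⊔ m) 0 (allFin n)

-- A partition of Fin n is given by a labelling P : Fin n → Fin n;
-- its parts are the nonempty fibres  {x | P x ≡ a}.
Partition : ℕ → Set
Partition n = Fin n → Fin n

eqF : ∀ {n} → Fin n → Fin n → Bool
eqF a b = does (a ≟ᶠ b)

inPart : ∀ {n} → Partition n → Fin n → Fin n → Bool
inPart P a x = eqF (P x) a

nonemptyPart : ∀ {n} → Partition n → Fin n → Bool
nonemptyPart P a = anyF (inPart P a)

qcol : ∀ {n} → Trigraph n → Partition n → Fin n → Fin n → Colour
qcol G P a b =
  if allF (λ u → allF (λ w → not (inPart P a u ∧ inPart P b w) Data.Bool.∨ isNone (col G u w)))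
  then none
  else (if allF (λ u → allF (λ w → not (inPart P a u ∧ inPart P b w) Data.Bool.∨ isBlack (col G u w)))
        then black else red)

redDeg : ∀ {n} → Trigraph n → Partition n → Fin n → ℕ
redDeg G P a = countF (λ b → not (eqF a b) ∧ nonemptyPart P b ∧ isRed (qcol G P a b))

MergeOf : ∀ {n} → Partition n → Partition n → Set
MergeOf {n} P Q = Σ (Fin n) λ u → Σ (Fin n) λ v → (P u ≢ P v) ×
  (∀ x y → (Q x ≡ Q y) ⇔ ((P x ≡ P y) ⊎ ((P x ≡ P u × P y ≡ P v) ⊎ (P x ≡ P v × P y ≡ P u))))

-- A contraction sequence P_n, ..., P_1 (indexed by the number of parts)
record ContractionSequence (n : ℕ) : Set where
  field
    P        : ℕ → Partition n
    discrete : ∀ x y → P n x ≡ P n y → x ≡ y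
    step     : ∀ i → 1 ≤ i → i < n → MergeOf (P (suc i)) (P i)
open ContractionSequence public

WidthAtMost : ∀ {n} → Trigraph n → ContractionSequence n → ℕ → Set
WidthAtMost {n} G S d = ∀ i → 1 ≤ i → i ≤ n → ∀ a → redDeg G (P S i) a ≤ d

IsTww : ∀ {n} → Trigraph n → ℕ → Set
IsTww {n} G t = (Σ (ContractionSequence n) λ S → WidthAtMost G S t)
              × (∀ d → Σ (ContractionSequence n) (λ S → WidthAtMost G S d) → t ≤ d)

IsStww : ∀ {n} → Trigraph n → ℕ → Set
IsStww G s = IsTww (Gred G) s

{-# OPTIONS --safe #-}
-- Reddening G changes each quotient G/P only by turning its black edges red,
-- so a part with no black neighbour in G/P has the same red degree in G_red/P.
-- A part U with a black neighbour W has all its vertices adjacent to any fixed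
-- w ∈ W, so |U| ≤ Δ; every red neighbour of U in G_red/P contains a neighbour
-- of some vertex of U, so there are at most |U|·Δ ≤ Δ² of them.  Hence a
-- contraction sequence of width t for G has width at most max(t, Δ²) for G_red,
-- while a sequence for G_red is one for G of no larger width:
-- tww G ≤ stww G ≤ max(tww G, Δ²).
module Submission where

open import Defs
open import Data.Bool using (Bool; true; false; T; _∧_; _∨_; not; if_then_else_)
  renaming (_≟_ to _≟ᵇ_)
open import Data.Bool.Properties using (T-∧)
open import Data.Empty using (⊥-elim)
open import Data.Fin using (Fin; zero; suc)
open import Data.Fin.Properties using (_≟_; any?; ¬∀⟶∃¬)
open import Data.List using (length; filter; foldr; tabulate)
open import Data.Nat using (ℕ; zero; suc; _*_; _^_; _≤_; _<_; _⊔_; z≤n)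
open import Data.Nat.Properties hiding (_≟_)
open import Algebra.Properties.Semiring.Sum +-*-semiring
  using (sum; sum-syntax; ∑-comm; *-distribʳ-sum; sum-cong-≗; sum-replicate-zero)
open import Data.Product using (∃; ∃₂; _×_; _,_; proj₁; proj₂)
open import Data.Sum using (inj₁; inj₂)
open import Function using (_∘_; _⇔_; mk⇔; Equivalence)
open import Relation.Nullary using (¬_; Dec; yes; no; does; contradiction)
open import Relation.Nullary.Decidable using (T?)
open import Relation.Binary.PropositionalEquality as ≡ using (_≡_; refl; cong; subst)

open Equivalence using (to; from)
open ≤-Reasoning

T-does : ∀ {A : Set} (A? : Dec A) → T (does A?) ⇔ A
T-does (yes A) = mk⇔ (λ _ → A) _
T-does (no ¬A) = mk⇔ (λ ()) ¬A

T-guarded : ∀ {A B : Set} (A? : Dec A) (B? : Dec B) z →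
  T (not (does A? ∧ does B?) ∨ z) ⇔ (A → B → T z)
T-guarded (yes A) (yes B) z = mk⇔ (λ t _ _ → t) (λ h → h A B)
T-guarded (yes _) (no ¬B) z = mk⇔ (λ _ _ B → contradiction B ¬B) _
T-guarded (no ¬A) B?      z = mk⇔ (λ _ A → contradiction A ¬A) _

¬T-guarded : ∀ {A B : Set} (A? : Dec A) (B? : Dec B) z →
  ¬ T (not (does A? ∧ does B?) ∨ z) → A × B × ¬ T z
¬T-guarded (yes A) (yes B) z ¬t = A , B , ¬t
¬T-guarded (yes _) (no _)  z ¬t = ⊥-elim (¬t _)
¬T-guarded (no _)  B?      z ¬t = ⊥-elim (¬t _)

∧-∧-monoʳ : ∀ x y {z z′} → (T z → T z′) → T (x ∧ y ∧ z) → T (x ∧ y ∧ z′)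
∧-∧-monoʳ true true z⇒z′ = z⇒z′

∧-∧-elimʳ : ∀ x y {z} → T (x ∧ y ∧ z) → T z
∧-∧-elimʳ true true z = z

𝟙 : Bool → ℕ
𝟙 b = if b then 1 else 0

𝟙≤ : ∀ {x k} → (T x → 1 ≤ k) → 𝟙 x ≤ k
𝟙≤ {false} _ = z≤n
𝟙≤ {true}  h = h _

1≤𝟙 : ∀ {x} → T x → 1 ≤ 𝟙 x
1≤𝟙 {true} _ = ≤-refl

sum-mono-≤ : ∀ {n} {f g : Fin n → ℕ} → (∀ i → f i ≤ g i) → sum f ≤ sum g
sum-mono-≤ {zero}  _   = z≤n
sum-mono-≤ {suc n} f≤g = +-mono-≤ (f≤g zero) (sum-mono-≤ (f≤g ∘ suc))

≤-sum : ∀ {n} (f : Fin n → ℕ) i → f i ≤ sum f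
≤-sum f zero    = m≤m+n _ _
≤-sum f (suc i) = ≤-trans (≤-sum (f ∘ suc) i) (m≤n+m _ _)

count : ∀ {n} → (Fin n → Bool) → ℕ
count p = sum (λ i → 𝟙 (p i))

count-mono : ∀ {n} {p q : Fin n → Bool} → (∀ i → T (p i) → T (q i)) → count p ≤ count q
count-mono p⇒q = sum-mono-≤ (λ i → 𝟙≤ (1≤𝟙 ∘ p⇒q i))

count-∧-≡ : ∀ {n} x (c : Fin n) → count (λ b → x ∧ eqF c b) ≡ 𝟙 x
count-∧-≡ {n}     false c       = sum-replicate-zero n
count-∧-≡ {suc n} true  zero    = cong suc (sum-replicate-zero n)
count-∧-≡ {suc n} true  (suc c) = count-∧-≡ true c

count-∧-≤ : ∀ {n} x (p : Fin n → Bool) k → count p ≤ k → count (λ i → x ∧ p i) ≤ 𝟙 x * k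
count-∧-≤ {n} false p k _   = ≤-reflexive (sum-replicate-zero n)
count-∧-≤     true  p k p≤k = ≤-trans p≤k (m≤m+n k 0)

-- Double counting: each b counted by p is charged to a pair (u , w) with
-- r u w and f w ≡ b, and each pair is charged at most once.
count-≤-cover : ∀ {l m n} (p : Fin n → Bool) (r : Fin l → Fin m → Bool) (f : Fin m → Fin n) →
  (∀ b → T (p b) → ∃₂ λ u w → T (r u w) × f w ≡ b) →
  count p ≤ ∑[ u < l ] count (r u)
count-≤-cover {l} {m} {n} p r f cover = begin
  count p                                    ≤⟨ sum-mono-≤ charge ⟩
  ∑[ b < n ] ∑[ u < l ] ∑[ w < m ] χ u w b   ≡⟨ ∑-comm (λ b u → ∑[ w < m ] χ u w b) ⟩
  ∑[ u < l ] ∑[ b < n ] ∑[ w < m ] χ u w b   ≡⟨ sum-cong-≗ (λ u → ∑-comm (λ b w → χ u w b)) ⟩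
  ∑[ u < l ] ∑[ w < m ] ∑[ b < n ] χ u w b   ≡⟨ sum-cong-≗ (λ u → sum-cong-≗ (λ w → count-∧-≡ (r u w) (f w))) ⟩
  ∑[ u < l ] count (r u)                     ∎
  where
  χ : Fin l → Fin m → Fin n → ℕ
  χ u w b = 𝟙 (r u w ∧ eqF (f w) b)
  charge : ∀ b → 𝟙 (p b) ≤ ∑[ u < l ] ∑[ w < m ] χ u w b
  charge b = 𝟙≤ λ pb → let (u , w , ruw , fw≡b) = cover b pb in begin
    1                                 ≤⟨ 1≤𝟙 (from T-∧ (ruw , from (T-does (f w ≟ b)) fw≡b)) ⟩
    χ u w b                           ≤⟨ ≤-sum _ w ⟩
    ∑[ w < m ] χ u w b                ≤⟨ ≤-sum _ u ⟩
    ∑[ u < l ] ∑[ w < m ] χ u w b     ∎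

count-tabulate : ∀ {A : Set} {n} (p : A → Bool) (g : Fin n → A) →
  length (filter (λ x → p x ≟ᵇ true) (tabulate g)) ≡ count (p ∘ g)
count-tabulate {n = zero}  p g = refl
count-tabulate {n = suc n} p g with p (g zero)
... | true  = cong suc (count-tabulate p (g ∘ suc))
... | false = count-tabulate p (g ∘ suc)

countF≡count : ∀ {n} (p : Fin n → Bool) → countF p ≡ count p
countF≡count p = count-tabulate p (λ i → i)

T-all-tabulate : ∀ {A : Set} {n} (p : A → Bool) (g : Fin n → A) →
  T (foldr (λ x b → p x ∧ b) true (tabulate g)) ⇔ (∀ i → T (p (g i)))
T-all-tabulate {n = zero}  p g = mk⇔ (λ _ ()) _
T-all-tabulate {n = suc n} p g = mk⇔ all⇒ ⇒all
  where
  ih : T (foldr (λ x b → p x ∧ b) true (tabulate (g ∘ suc))) ⇔ (∀ i → T (p (g (suc i))))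
  ih = T-all-tabulate p (g ∘ suc)
  all⇒ : T (p (g zero) ∧ foldr (λ x b → p x ∧ b) true (tabulate (g ∘ suc))) → ∀ i → T (p (g i))
  all⇒ h zero    = proj₁ (to T-∧ h)
  all⇒ h (suc i) = to ih (proj₂ (to T-∧ h)) i
  ⇒all : (∀ i → T (p (g i))) → T (p (g zero) ∧ foldr (λ x b → p x ∧ b) true (tabulate (g ∘ suc)))
  ⇒all h = from T-∧ (h zero , from ih (h ∘ suc))

T-allF : ∀ {n} (p : Fin n → Bool) → T (allF p) ⇔ (∀ x → T (p x))
T-allF p = T-all-tabulate p (λ i → i)

allF-witness : ∀ {n} (p : Fin n → Bool) → ¬ T (allF p) → ∃ λ x → ¬ T (p x)
allF-witness {n} p ¬all = ¬∀⟶∃¬ n _ (T? ∘ p) (¬all ∘ from (T-allF p))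

≤-foldr-⊔-tabulate : ∀ {A : Set} {n} (f : A → ℕ) (g : Fin n → A) i →
  f (g i) ≤ foldr (λ x k → f x ⊔ k) 0 (tabulate g)
≤-foldr-⊔-tabulate f g zero    = m≤m⊔n _ _
≤-foldr-⊔-tabulate f g (suc i) = ≤-trans (≤-foldr-⊔-tabulate f (g ∘ suc) i) (m≤n⊔m _ _)

count-neighbours≤Δ : ∀ {n} (G : Trigraph n) v → count (λ w → isEdge (col G v w)) ≤ Δ G
count-neighbours≤Δ G v = subst (_≤ Δ G) (countF≡count (λ w → isEdge (col G v w)))
  (≤-foldr-⊔-tabulate (deg G) (λ i → i) v)

allPairs : ∀ {n} → Partition n → Fin n → Fin n → (Fin n → Fin n → Bool) → Bool
allPairs P a b r = allF (λ u → allF (λ w → not (inPart P a u ∧ inPart P b w) ∨ r u w))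

T-allPairs : ∀ {n} (P : Partition n) a b (r : Fin n → Fin n → Bool) →
  T (allPairs P a b r) ⇔ (∀ u w → P u ≡ a → P w ≡ b → T (r u w))
T-allPairs P a b r = mk⇔
  (λ all u w → to (guarded u w) (to (T-allF _) (to (T-allF _) all u) w))
  (λ h → from (T-allF _) λ u → from (T-allF _) λ w → from (guarded u w) (h u w))
  where
  guarded : ∀ u w → T (not (inPart P a u ∧ inPart P b w) ∨ r u w) ⇔ (P u ≡ a → P w ≡ b → T (r u w))
  guarded u w = T-guarded (P u ≟ a) (P w ≟ b) (r u w)

allPairs-mono : ∀ {n} (P : Partition n) a b {r r′ : Fin n → Fin n → Bool} →
  (∀ u w → T (r u w) → T (r′ u w)) → T (allPairs P a b r) → T (allPairs P a b r′)
allPairs-mono P a b {r} {r′} r⇒r′ all =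
  from (T-allPairs P a b r′) λ u w Pu Pw → r⇒r′ u w (to (T-allPairs P a b r) all u w Pu Pw)

allPairs-witness : ∀ {n} (P : Partition n) a b (r : Fin n → Fin n → Bool) →
  ¬ T (allPairs P a b r) → ∃₂ λ u w → P u ≡ a × P w ≡ b × ¬ T (r u w)
allPairs-witness P a b r ¬all =
  let (u , ¬rowᵤ)   = allF-witness _ ¬all
      (w , ¬pairᵤʷ) = allF-witness _ ¬rowᵤ
  in u , w , ¬T-guarded (P u ≟ a) (P w ≟ b) (r u w) ¬pairᵤʷ

isEdge-redden : ∀ c → T (isEdge (redden c)) → T (isEdge c)
isEdge-redden black _ = _
isEdge-redden red   _ = _

isNone-redden : ∀ c → isNone (redden c) ≡ isNone c
isNone-redden none  = refl
isNone-redden black = refl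
isNone-redden red   = refl

¬isBlack-redden : ∀ c → ¬ T (isBlack (redden c))
¬isBlack-redden none  ()
¬isBlack-redden black ()
¬isBlack-redden red   ()

isRed-redden : ∀ c → T (isRed c) → T (isRed (redden c))
isRed-redden red _ = _

isRed-redden⁻ : ∀ c → T (isRed (redden c)) → ¬ T (isBlack c) → T (isRed c)
isRed-redden⁻ black _ ¬black = ¬black _
isRed-redden⁻ red   _ _      = _

isRed⇒isEdge : ∀ c → T (isRed c) → T (isEdge c)
isRed⇒isEdge red _ = _

isBlack⇒isEdge : ∀ c → T (isBlack c) → T (isEdge c)
isBlack⇒isEdge black _ = _

¬isNone⇒isEdge : ∀ c → ¬ T (isNone c) → T (isEdge c)
¬isNone⇒isEdge none  ¬none = ¬none _
¬isNone⇒isEdge black _     = _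
¬isNone⇒isEdge red   _     = _

-- qcol G P a b unfolds to classify (noEdge G P a b) (allBlack G P a b).
classify : Bool → Bool → Colour
classify noEdge allBlack = if noEdge then none else if allBlack then black else red

noEdge allBlack : ∀ {n} → Trigraph n → Partition n → Fin n → Fin n → Bool
noEdge   G P a b = allPairs P a b (λ u w → isNone (col G u w))
allBlack G P a b = allPairs P a b (λ u w → isBlack (col G u w))

isEdge-classify : ∀ x y → T (isEdge (classify x y)) → ¬ T x
isEdge-classify true  y ()
isEdge-classify false y _ ()

isBlack-classify : ∀ x y → T (isBlack (classify x y)) → T y
isBlack-classify false true  _ = _
isBlack-classify false false ()
isBlack-classify true  y     ()

classify-redden : ∀ x y x′ y′ → (T x ⇔ T x′) → (T y → T x′) →
  classify x y ≡ redden (classify x′ y′)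
classify-redden true  _     true  _     _    _    = refl
classify-redden false false false true  _    _    = refl
classify-redden false false false false _    _    = refl
classify-redden false true  false _     _    y⇒x′ = ⊥-elim (y⇒x′ _)
classify-redden true  _     false _     x⇔x′ _    = ⊥-elim (to x⇔x′ _)
classify-redden false _     true  _     x⇔x′ _    = ⊥-elim (from x⇔x′ _)

qcol-Gred : ∀ {n} (G : Trigraph n) P a b → qcol (Gred G) P a b ≡ redden (qcol G P a b)
qcol-Gred G P a b = classify-redden
  (noEdge (Gred G) P a b) (allBlack (Gred G) P a b) (noEdge G P a b) (allBlack G P a b)
  (mk⇔ (allPairs-mono P a b λ u w → subst T (isNone-redden (col G u w)))
       (allPairs-mono P a b λ u w → subst T (≡.sym (isNone-redden (col G u w)))))
  (allPairs-mono P a b λ u w → ⊥-elim ∘ ¬isBlack-redden (col G u w))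

qcol-edge : ∀ {n} (H : Trigraph n) P a b → T (isEdge (qcol H P a b)) →
  ∃₂ λ u w → P u ≡ a × P w ≡ b × T (isEdge (col H u w))
qcol-edge H P a b edge =
  let (u , w , Pu , Pw , ¬none) = allPairs-witness P a b (λ u w → isNone (col H u w))
                                    (isEdge-classify (noEdge H P a b) (allBlack H P a b) edge)
  in u , w , Pu , Pw , ¬isNone⇒isEdge (col H u w) ¬none

-- A black edge U–W in G/P makes every vertex of U adjacent to a fixed w ∈ W.
black⇒part-size≤Δ : ∀ {n} (G : Trigraph n) P a b → T (isBlack (qcol G P a b)) →
  count (inPart P a) ≤ Δ G
black⇒part-size≤Δ G P a b ab-black with qcol-edge G P a b (isBlack⇒isEdge _ ab-black)
... | _ , w , _ , Pw , _ = ≤-trans (count-mono adjacent) (count-neighbours≤Δ G w)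
  where
  all-black : ∀ u w → P u ≡ a → P w ≡ b → T (isBlack (col G u w))
  all-black = to (T-allPairs P a b _) (isBlack-classify (noEdge G P a b) (allBlack G P a b) ab-black)
  adjacent : ∀ u → T (inPart P a u) → T (isEdge (col G w u))
  adjacent u u∈a = subst (T ∘ isEdge) (sym G u w)
    (isBlack⇒isEdge _ (all-black u w (to (T-does (P u ≟ a)) u∈a) Pw))

redNeighbour : ∀ {n} → Trigraph n → Partition n → Fin n → Fin n → Bool
redNeighbour G P a b = not (eqF a b) ∧ nonemptyPart P b ∧ isRed (qcol G P a b)

redDeg≡count : ∀ {n} (G : Trigraph n) P a → redDeg G P a ≡ count (redNeighbour G P a)
redDeg≡count G P a = countF≡count (redNeighbour G P a)

redDeg-mono : ∀ {n} (G H : Trigraph n) P a →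
  (∀ b → T (isRed (qcol G P a b)) → T (isRed (qcol H P a b))) → redDeg G P a ≤ redDeg H P a
redDeg-mono G H P a red⇒red = begin
  redDeg G P a                ≡⟨ redDeg≡count G P a ⟩
  count (redNeighbour G P a)  ≤⟨ count-mono (λ b → ∧-∧-monoʳ (not (eqF a b)) (nonemptyPart P b) (red⇒red b)) ⟩
  count (redNeighbour H P a)  ≡⟨ redDeg≡count H P a ⟨
  redDeg H P a                ∎

redDeg≤redDeg-Gred : ∀ {n} (G : Trigraph n) P a → redDeg G P a ≤ redDeg (Gred G) P a
redDeg≤redDeg-Gred G P a = redDeg-mono G (Gred G) P a λ b red →
  subst (T ∘ isRed) (≡.sym (qcol-Gred G P a b)) (isRed-redden (qcol G P a b) red)

redDeg-Gred≤redDeg : ∀ {n} (G : Trigraph n) P a →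
  (∀ b → ¬ T (isBlack (qcol G P a b))) → redDeg (Gred G) P a ≤ redDeg G P a
redDeg-Gred≤redDeg G P a ¬black = redDeg-mono (Gred G) G P a λ b red →
  isRed-redden⁻ (qcol G P a b) (subst (T ∘ isRed) (qcol-Gred G P a b) red) (¬black b)

redDeg-Gred≤Δ² : ∀ {n} (G : Trigraph n) P a b → T (isBlack (qcol G P a b)) →
  redDeg (Gred G) P a ≤ Δ G ^ 2
redDeg-Gred≤Δ² {n} G P a b ab-black = begin
  redDeg (Gred G) P a                  ≡⟨ redDeg≡count (Gred G) P a ⟩
  count (redNeighbour (Gred G) P a)    ≤⟨ count-≤-cover (redNeighbour (Gred G) P a) incident P lift ⟩
  ∑[ u < n ] count (incident u)        ≤⟨ sum-mono-≤ incident≤ ⟩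
  ∑[ u < n ] (𝟙 (inPart P a u) * Δ G)  ≡⟨ *-distribʳ-sum (Δ G) (𝟙 ∘ inPart P a) ⟨
  count (inPart P a) * Δ G             ≤⟨ *-monoˡ-≤ (Δ G) (black⇒part-size≤Δ G P a b ab-black) ⟩
  Δ G * Δ G                            ≡⟨ cong (Δ G *_) (*-identityʳ (Δ G)) ⟨
  Δ G ^ 2                              ∎
  where
  incident : Fin n → Fin n → Bool
  incident u w = inPart P a u ∧ isEdge (col G u w)
  incident≤ : ∀ u → count (incident u) ≤ 𝟙 (inPart P a u) * Δ G
  incident≤ u = count-∧-≤ (inPart P a u) (isEdge ∘ col G u) (Δ G) (count-neighbours≤Δ G u)
  lift : ∀ c → T (redNeighbour (Gred G) P a c) → ∃₂ λ u w → T (incident u w) × P w ≡ c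
  lift c ac-red with qcol-edge (Gred G) P a c
                       (isRed⇒isEdge _ (∧-∧-elimʳ (not (eqF a c)) (nonemptyPart P c) ac-red))
  ... | u , w , Pu , Pw , uw =
    u , w , from T-∧ (from (T-does (P u ≟ a)) Pu , isEdge-redden (col G u w) uw) , Pw

redDeg-Gred≤ : ∀ {n} (G : Trigraph n) P a {t} → redDeg G P a ≤ t →
  redDeg (Gred G) P a ≤ t ⊔ Δ G ^ 2
redDeg-Gred≤ G P a {t} ≤t with any? (λ b → T? (isBlack (qcol G P a b)))
... | yes (b , ab-black) = ≤-trans (redDeg-Gred≤Δ² G P a b ab-black) (m≤n⊔m t _)
... | no ¬black          =
  ≤-trans (redDeg-Gred≤redDeg G P a (λ b → ¬black ∘ (b ,_))) (≤-trans ≤t (m≤m⊔n t _))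

tww≤stww : ∀ {n} (G : Trigraph n) {s t} → IsStww G s → IsTww G t → t ≤ s
tww≤stww G {s} ((S , width) , _) (_ , minimal) = minimal s
  (S , λ i 1≤i i≤n a → ≤-trans (redDeg≤redDeg-Gred G (P S i) a) (width i 1≤i i≤n a))

stww≤tww⊔Δ² : ∀ {n} (G : Trigraph n) {s t} → IsStww G s → IsTww G t → s ≤ t ⊔ Δ G ^ 2
stww≤tww⊔Δ² G {s} {t} (_ , minimal) ((S , width) , _) = minimal (t ⊔ Δ G ^ 2)
  (S , λ i 1≤i i≤n a → redDeg-Gred≤ G (P S i) a (width i 1≤i i≤n a))

lemma3p1 : ∀ (n : ℕ) (G : Trigraph n) (s t : ℕ) →
    IsStww G s → IsTww G t → Δ G ^ 2 < s → s ≡ t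
lemma3p1 n G s t stww tww Δ²<s with ⊔-sel t (Δ G ^ 2)
... | inj₁ t⊔Δ²≡t  = ≤-antisym (subst (s ≤_) t⊔Δ²≡t (stww≤tww⊔Δ² G stww tww)) (tww≤stww G stww tww)
... | inj₂ t⊔Δ²≡Δ² = ⊥-elim (<⇒≱ Δ²<s (subst (s ≤_) t⊔Δ²≡Δ² (stww≤tww⊔Δ² G stww tww)))
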